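{- Fix integers $k \ge 3$ and $i \in \{2,\dots,k-1\}$. Let $d \ge 1$ and $x \in \mathbb{Z}_k^d$. Then $\mathbb{Z}_k^d \setminus \{x\}$ is a disjoint union of copies of $T$.
   Context: $\mathbb{Z}_k$ denotes the integers modulo $k$. Let $T = \{1,\dots,k\}\setminus\{i\}$ and identify $T$ with its image in $\mathbb{Z}_k$ under the natural projection (so it is $\mathbb{Z}_k$ minus one element). A copy of $T$ in $\mathbb{Z}_k^d$ is a set of the form $\{y + t e_j : t \in \mathbb{Z}_k,\ t \neq a\}$ for some $y \in \mathbb{Z}_k^d$, some coordinate direction $j \in \{1,\dots,d\}$ (with $e_j$ the $j$-th standard basis vector) and some $a \in \mathbb{Z}_k$; i.e. a line in a coordinate direction with one point removed. -}

module Defs where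

open import Data.Nat using (ℕ; NonZero; _+_)
open import Data.Nat.DivMod using (_%_; m%n<n)
open import Data.Fin using (Fin; toℕ; fromℕ<; _≟_)
open import Data.Vec using (Vec; zipWith; tabulate)
open import Relation.Nullary using (¬_)
open import Relation.Nullary.Decidable using (⌊_⌋)
open import Data.Bool using (if_then_else_)
open import Relation.Binary.PropositionalEquality using (_≡_; _≢_)
open import Data.Product using (Σ; ∃; _×_)

-- ℤ_k is represented by Fin k, with addition modulo k.
_+ₖ_ : ∀ {k} .{{_ : NonZero k}} → Fin k → Fin k → Fin k
_+ₖ_ {k} a b = fromℕ< (m%n<n (toℕ a + toℕ b) k)

0ₖ : ∀ {k} .{{_ : NonZero k}} → Fin k
0ₖ {k} = fromℕ< (m%n<n 0 k)

Pt : ℕ → ℕ → Set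
Pt k d = Vec (Fin k) d

_⊕_ : ∀ {k d} .{{_ : NonZero k}} → Pt k d → Pt k d → Pt k d
_⊕_ = zipWith _+ₖ_

_·e_ : ∀ {k d} .{{_ : NonZero k}} → Fin k → Fin d → Pt k d
t ·e j = tabulate λ l → if ⌊ l ≟ j ⌋ then t else 0ₖ

-- Parameters (y, j, a) of a copy of T:  { y + t e_j : t ∈ ℤ_k, t ≠ a }
record CopyT (k d : ℕ) : Set where
  constructor copy
  field
    base : Pt k d
    dir  : Fin d
    miss : Fin k

_∈T_ : ∀ {k d} .{{_ : NonZero k}} → Pt k d → CopyT k d → Set
p ∈T copy y j a = ∃ λ t → t ≢ a × p ≡ y ⊕ (t ·e j)

DisjointUnionOfCopiesOfT : ∀ {k d} .{{_ : NonZero k}} → Pt k d → (m : ℕ) → (Fin m → CopyT k d) → Set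
DisjointUnionOfCopiesOfT x m F =
  (∀ l → ¬ (x ∈T F l)) ×
  (∀ p → p ≢ x → Σ (Fin m) λ l → (p ∈T F l) × (∀ l′ → p ∈T F l′ → l′ ≡ l))

module Submission where

-- Write points of ℤ_k^(d+1) as p₀ ∷ p′ and let x = x₀ ∷ x′.
-- The points with p₀ ≢ x₀ are covered exactly by the lines
--   { t ∷ y : t ≢ x₀ }   (one for each y ∈ ℤ_k^d, direction e₁, missing x₀),
-- while the points with p₀ ≡ x₀ form the hyperplane x₀ ∷ ℤ_k^d, in which
-- x₀ ∷ x′ is removed; there we reuse, prefixed by x₀, a partition of
-- ℤ_k^d ∖ {x′} obtained by induction on d.  The set T is ℤ_k minus one
-- point whatever i is, so the argument works for every k ≥ 1 and d ≥ 0.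

open import Defs
open import Data.Nat using (ℕ; NonZero; >-nonZero⁻¹; _≤_; _<_; zero; suc; _+_; _^_)
open import Data.Nat.Properties using (+-identityʳ)
open import Data.Nat.DivMod using (_%_; m<n⇒m%n≡m)
open import Data.Product using (Σ; _×_; _,_; proj₁; proj₂; uncurry)
open import Data.Product.Function.NonDependent.Propositional using (_×-↔_)
open import Data.Fin as Fin using (Fin; toℕ; _≟_)
open import Data.Fin.Properties using (toℕ-injective; toℕ-fromℕ<; toℕ<n; +↔⊎; *↔×; 1↔⊤)
open import Data.Vec using ([]; _∷_; tabulate; uncons)
open import Data.Vec.Properties using (tabulate-cong; ∷-injective)
open import Data.Sum using (_⊎_; inj₁; inj₂)
open import Data.Sum.Function.Propositional using (_⊎-↔_)
open import Data.Empty using (⊥; ⊥-elim)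
open import Data.Unit using (tt)
open import Function using (_∘_)
open import Function.Bundles using (_↔_; Inverse; mk↔ₛ′)
open import Function.Properties.Inverse using (↔-refl; ↔-trans)
open import Relation.Nullary using (¬_; yes; no)
open import Relation.Nullary.Decidable using (⌊⌋-map′)
open import Relation.Binary.PropositionalEquality
open import Data.Bool using (if_then_else_)

Partition : ∀ {k d} .{{_ : NonZero k}} → Pt k d → (I : Set) → (I → CopyT k d) → Set
Partition x I F =
  (∀ l → ¬ (x ∈T F l)) ×
  (∀ p → p ≢ x → Σ I λ l → (p ∈T F l) × (∀ l′ → p ∈T F l′ → l′ ≡ l))

reindex : ∀ {k d m} {I : Set} .{{_ : NonZero k}} {x : Pt k d} {F : I → CopyT k d} →
          (e : Fin m ↔ I) → Partition x I F → Partition x (Fin m) (F ∘ Inverse.to e)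
reindex {m = m} {x = x} {F} e (outside , cover) = outside ∘ to , cover′
  where
  open Inverse e
  cover′ : ∀ p → p ≢ x → Σ (Fin m) λ n → (p ∈T F (to n)) × (∀ n′ → p ∈T F (to n′) → n′ ≡ n)
  cover′ p p≢x with cover p p≢x
  ... | l , p∈l , unique =
    from l ,
    subst (λ l′ → p ∈T F l′) (sym (strictlyInverseˡ l)) p∈l ,
    λ n′ p∈n′ → trans (sym (strictlyInverseʳ n′)) (cong from (unique (to n′) p∈n′))

module _ {k : ℕ} .{{_ : NonZero k}} where

  toℕ-0ₖ : toℕ (0ₖ {k}) ≡ 0
  toℕ-0ₖ = trans (toℕ-fromℕ< _) (m<n⇒m%n≡m (>-nonZero⁻¹ k))

  +ₖ-identityʳ : (a : Fin k) → a +ₖ 0ₖ ≡ a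
  +ₖ-identityʳ a = toℕ-injective (begin
    toℕ (a +ₖ 0ₖ)          ≡⟨ toℕ-fromℕ< _ ⟩
    (toℕ a + toℕ 0ₖ) % k   ≡⟨ cong (λ z → (toℕ a + z) % k) toℕ-0ₖ ⟩
    (toℕ a + 0) % k        ≡⟨ cong (_% k) (+-identityʳ (toℕ a)) ⟩
    toℕ a % k              ≡⟨ m<n⇒m%n≡m (toℕ<n a) ⟩
    toℕ a                  ∎)
    where open ≡-Reasoning

  +ₖ-identityˡ : (a : Fin k) → 0ₖ +ₖ a ≡ a
  +ₖ-identityˡ a = toℕ-injective (begin
    toℕ (0ₖ +ₖ a)        ≡⟨ toℕ-fromℕ< _ ⟩
    (toℕ 0ₖ + toℕ a) % k ≡⟨ cong (λ z → (z + toℕ a) % k) toℕ-0ₖ ⟩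
    toℕ a % k            ≡⟨ m<n⇒m%n≡m (toℕ<n a) ⟩
    toℕ a                ∎)
    where open ≡-Reasoning

  ⊕-identityʳ : ∀ {d} (y : Pt k d) → y ⊕ tabulate (λ _ → 0ₖ) ≡ y
  ⊕-identityʳ []      = refl
  ⊕-identityʳ (a ∷ y) = cong₂ _∷_ (+ₖ-identityʳ a) (⊕-identityʳ y)

  ⊕-e-zero : ∀ {d} (y : Pt k d) t → (0ₖ ∷ y) ⊕ (t ·e Fin.zero) ≡ t ∷ y
  ⊕-e-zero y t = cong₂ _∷_ (+ₖ-identityˡ t) (⊕-identityʳ y)

  ⊕-e-suc : ∀ {d} x₀ (y : Pt k d) t j → (x₀ ∷ y) ⊕ (t ·e Fin.suc j) ≡ x₀ ∷ (y ⊕ (t ·e j))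
  ⊕-e-suc x₀ y t j = cong₂ _∷_ (+ₖ-identityʳ x₀) (cong (y ⊕_)
    (tabulate-cong (λ l → cong (λ b → if b then t else 0ₖ) (⌊⌋-map′ _ _ (l ≟ j)))))

  line : ∀ {d} → Fin k → Pt k d → CopyT k (suc d)
  line a y = copy (0ₖ ∷ y) Fin.zero a

  ∈-line⁺ : ∀ {d} p₀ (y : Pt k d) a → p₀ ≢ a → (p₀ ∷ y) ∈T line a y
  ∈-line⁺ p₀ y a p₀≢a = p₀ , p₀≢a , sym (⊕-e-zero y p₀)

  ∈-line⁻ : ∀ {d} p₀ (p′ y : Pt k d) a → (p₀ ∷ p′) ∈T line a y → (p₀ ≢ a) × (p′ ≡ y)
  ∈-line⁻ p₀ p′ y a (t , t≢a , eq) with ∷-injective (trans eq (⊕-e-zero y t))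
  ... | refl , p′≡y = t≢a , p′≡y

  lift : ∀ {d} → Fin k → CopyT k d → CopyT k (suc d)
  lift x₀ (copy y j a) = copy (x₀ ∷ y) (Fin.suc j) a

  ∈-lift⁺ : ∀ {d} (p′ : Pt k d) x₀ c → p′ ∈T c → (x₀ ∷ p′) ∈T lift x₀ c
  ∈-lift⁺ p′ x₀ (copy y j a) (t , t≢a , eq) =
    t , t≢a , trans (cong (x₀ ∷_) eq) (sym (⊕-e-suc x₀ y t j))

  ∈-lift⁻ : ∀ {d} p₀ (p′ : Pt k d) x₀ c → (p₀ ∷ p′) ∈T lift x₀ c → (p₀ ≡ x₀) × (p′ ∈T c)
  ∈-lift⁻ p₀ p′ x₀ (copy y j a) (t , t≢a , eq) with ∷-injective (trans eq (⊕-e-suc x₀ y t j))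
  ... | p₀≡x₀ , p′-eq = p₀≡x₀ , (t , t≢a , p′-eq)

  extend : ∀ {d} {I : Set} → Fin k → (I → CopyT k d) → (Pt k d ⊎ I → CopyT k (suc d))
  extend x₀ F (inj₁ y) = line x₀ y
  extend x₀ F (inj₂ l) = lift x₀ (F l)

  partition-step : ∀ {d} {I : Set} {x′ : Pt k d} {F : I → CopyT k d} (x₀ : Fin k) →
                   Partition x′ I F → Partition (x₀ ∷ x′) (Pt k d ⊎ I) (extend x₀ F)
  partition-step {d} {I} {x′} {F} x₀ (outside , cover) = outside′ , cover′
    where
    outside′ : ∀ l → ¬ ((x₀ ∷ x′) ∈T extend x₀ F l)
    outside′ (inj₁ y) x∈ = proj₁ (∈-line⁻ x₀ x′ y x₀ x∈) refl
    outside′ (inj₂ l) x∈ = outside l (proj₂ (∈-lift⁻ x₀ x′ x₀ (F l) x∈))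

    cover′ : ∀ p → p ≢ x₀ ∷ x′ → Σ (Pt k d ⊎ I) λ l →
             (p ∈T extend x₀ F l) × (∀ l′ → p ∈T extend x₀ F l′ → l′ ≡ l)
    cover′ (p₀ ∷ p′) p≢x with p₀ ≟ x₀
    ... | no p₀≢x₀ = inj₁ p′ , ∈-line⁺ p₀ p′ x₀ p₀≢x₀ , unique
      where
      unique : ∀ l′ → (p₀ ∷ p′) ∈T extend x₀ F l′ → l′ ≡ inj₁ p′
      unique (inj₁ y) p∈ = cong inj₁ (sym (proj₂ (∈-line⁻ p₀ p′ y x₀ p∈)))
      unique (inj₂ l) p∈ = ⊥-elim (p₀≢x₀ (proj₁ (∈-lift⁻ p₀ p′ x₀ (F l) p∈)))
    ... | yes refl with cover p′ (p≢x ∘ cong (p₀ ∷_))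
    ...   | l , p′∈l , unique′ = inj₂ l , ∈-lift⁺ p′ p₀ (F l) p′∈l , unique
      where
      unique : ∀ l′ → (p₀ ∷ p′) ∈T extend p₀ F l′ → l′ ≡ inj₂ l
      unique (inj₁ y)  p∈ = ⊥-elim (proj₁ (∈-line⁻ p₀ p′ y p₀ p∈) refl)
      unique (inj₂ l′) p∈ = cong inj₂ (unique′ l′ (proj₂ (∈-lift⁻ p₀ p′ p₀ (F l′) p∈)))

  Index : ℕ → Set
  Index zero    = ⊥
  Index (suc d) = Pt k d ⊎ Index d

  copies : ∀ {d} → Pt k d → Index d → CopyT k d
  copies []       ()
  copies (x₀ ∷ x′) = extend x₀ (copies x′)

  copies-partition : ∀ {d} (x : Pt k d) → Partition x (Index d) (copies x)
  copies-partition []        = (λ ()) , λ { [] []≢[] → ⊥-elim ([]≢[] refl) }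
  copies-partition (x₀ ∷ x′) = partition-step x₀ (copies-partition x′)

Pt-enum : ∀ k d → Fin (k ^ d) ↔ Pt k d
Pt-enum k zero    = ↔-trans 1↔⊤ (mk↔ₛ′ (λ _ → []) (λ _ → tt) (λ { [] → refl }) (λ _ → refl))
Pt-enum k (suc d) = ↔-trans *↔× (↔-trans (↔-refl ×-↔ Pt-enum k d) cons↔)
  where
  cons↔ : (Fin k × Pt k d) ↔ Pt k (suc d)
  cons↔ = mk↔ₛ′ (uncurry _∷_) uncons (λ { (_ ∷ _) → refl }) (λ _ → refl)

Index-size : ℕ → ℕ → ℕ
Index-size k zero    = 0
Index-size k (suc d) = k ^ d + Index-size k d

Index-enum : ∀ k .{{_ : NonZero k}} d → Fin (Index-size k d) ↔ Index d
Index-enum k zero    = mk↔ₛ′ (λ ()) (λ ()) (λ ()) (λ ())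
Index-enum k (suc d) = ↔-trans +↔⊎ (Pt-enum k d ⊎-↔ Index-enum k d)

proposition4 : (k : ℕ) .{{_ : NonZero k}} → 3 ≤ k → (i : ℕ) → 2 ≤ i → i < k →
    (d : ℕ) → 1 ≤ d → (x : Pt k d) →
    Σ ℕ λ m → Σ (Fin m → CopyT k d) λ F → DisjointUnionOfCopiesOfT x m F
proposition4 k _ _ _ _ d _ x =
  Index-size k d , copies x ∘ Inverse.to (Index-enum k d) ,
  reindex (Index-enum k d) (copies-partition x)
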